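{- For integers $x\ge 0$ let $\Delta_3(x)=S_{3,0}(x)-S_{3,0}(4\lfloor x/4\rfloor)$. Then $$\Delta_3(x)=\begin{cases}(-1)^{s_2(x-1)}, & x\equiv 1,7,10 \pmod{12},\\ (-1)^{s_2(x-2)}, & x\equiv 2,11\pmod{12},\\ (-1)^{s_2(x-3)}, & x\equiv 3\pmod{12},\\ 0, & \text{otherwise}.\end{cases}$$
   Context: For an integer $b\ge 2$ and integer $r\ge 0$, $s_b(r)$ denotes the sum of the digits of $r$ in base $b$. For integers $x\ge 0$, define $$S_{3,0}(x)=\sum_{0\le r<x,\; r\equiv 0 \pmod 3}(-1)^{s_{2}(r)}.$$ -}

module Defs where

open import Data.Nat using (ℕ; zero; suc; _+_; _*_; _∸_; _/_; _%_; _≟_)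
open import Data.Integer using (ℤ; +_; -_)
import Data.Integer as ℤ
open import Relation.Nullary using (yes; no)

-- Sum of base-2 digits, s₂(r), by the recursion s₂(0)=0, s₂(r)=(r mod 2)+s₂(⌊r/2⌋).
-- Defined with fuel r (⌊r/2⌋ < r for r ≥ 1, so fuel r suffices).
s₂-fuel : ℕ → ℕ → ℕ
s₂-fuel zero    r = 0
s₂-fuel (suc f) r = r % 2 + s₂-fuel f (r / 2)

s₂ : ℕ → ℕ
s₂ r = s₂-fuel r r

neg1^ : ℕ → ℤ
neg1^ zero    = + 1
neg1^ (suc k) = - neg1^ k

S30 : ℕ → ℤ
S30 zero    = + 0
S30 (suc x) with x % 3 ≟ 0
... | yes _ = S30 x ℤ.+ neg1^ (s₂ x)
... | no  _ = S30 x

Δ₃ : ℕ → ℤ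
Δ₃ x = S30 x ℤ.- S30 (4 * (x / 4))

Δ₃-rhs : ℕ → ℤ
Δ₃-rhs x with x % 12
... | 1  = neg1^ (s₂ (x ∸ 1))
... | 7  = neg1^ (s₂ (x ∸ 1))
... | 10 = neg1^ (s₂ (x ∸ 1))
... | 2  = neg1^ (s₂ (x ∸ 2))
... | 11 = neg1^ (s₂ (x ∸ 2))
... | 3  = neg1^ (s₂ (x ∸ 3))
... | _  = + 0

module Submission where

-- Δ₃(x) = S_{3,0}(x) − S_{3,0}(4⌊x/4⌋) is the part of the sum S_{3,0} contributed by
-- the at most three indices r with 4⌊x/4⌋ ≤ r < x.  The proof makes this precise:
--
--   * `term r` is the contribution of r to S_{3,0}, and `window a d` is the sum of
--     the contributions of a, a+1, …, a+d−1, so that S_{3,0}(d + a) = S_{3,0}(a) + window a d;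
--   * hence Δ₃(s + a) = window a s whenever 4 ∣ a and s < 4;
--   * the contribution of c + 12k depends only on c mod 3, which is 0 exactly for one
--     index of each window, so for x = r + 12k with r < 12 the window is computed by hand
--     case by case; the surviving index is x − 1, x − 2 or x − 3, as the case table says.
--
-- The theorem follows by writing x = (x mod 12) + 12⌊x/12⌋.

open import Defs
open import Data.Nat using (ℕ; zero; suc; _+_; _*_; _/_; _%_; _≟_; _<_; _<?_; NonZero; s≤s)
open import Data.Nat.Properties using (*-assoc)
open import Data.Nat.DivMod
  using ([m+kn]%n≡m%n; m≡m%n+[m/n]*n; m%n<n; m*[n/m]≡n; m<n⇒m/n≡0; +-distrib-/-∣ʳ)
open import Data.Nat.Divisibility using (_∣_; _∣?_; divides; ∣m∣n⇒∣m+n)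
open import Data.Integer using (ℤ; +_)
import Data.Integer as ℤ
import Data.Integer.Properties as ℤP
open import Algebra.Properties.AbelianGroup ℤP.+-0-abelianGroup using (xyx⁻¹≈y)
open import Relation.Nullary using (yes; no)
open import Relation.Nullary.Decidable using (True; toWitness)
open import Relation.Binary.PropositionalEquality
  using (_≡_; _≢_; refl; sym; trans; cong; subst; module ≡-Reasoning)
open import Data.Empty using (⊥-elim)

term : ℕ → ℤ
term r with r % 3 ≟ 0
... | yes _ = neg1^ (s₂ r)
... | no  _ = + 0

S30-suc : ∀ n → S30 (suc n) ≡ S30 n ℤ.+ term n
S30-suc n with n % 3 ≟ 0
... | yes _ = refl
... | no  _ = sym (ℤP.+-identityʳ (S30 n))

term-on : ∀ n → n % 3 ≡ 0 → term n ≡ neg1^ (s₂ n)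
term-on n n≡0 with n % 3 ≟ 0
... | yes _   = refl
... | no  n≢0 = ⊥-elim (n≢0 n≡0)

term-off : ∀ n → n % 3 ≢ 0 → term n ≡ + 0
term-off n n≢0 with n % 3 ≟ 0
... | yes n≡0 = ⊥-elim (n≢0 n≡0)
... | no  _   = refl

window : ℕ → ℕ → ℤ
window a zero    = + 0
window a (suc d) = window a d ℤ.+ term (d + a)

S30-split : ∀ d a → S30 (d + a) ≡ S30 a ℤ.+ window a d
S30-split zero    a = sym (ℤP.+-identityʳ (S30 a))
S30-split (suc d) a = begin
  S30 (suc d + a)                               ≡⟨ S30-suc (d + a) ⟩
  S30 (d + a) ℤ.+ term (d + a)                  ≡⟨ cong (ℤ._+ term (d + a)) (S30-split d a) ⟩
  (S30 a ℤ.+ window a d) ℤ.+ term (d + a)       ≡⟨ ℤP.+-assoc (S30 a) (window a d) (term (d + a)) ⟩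
  S30 a ℤ.+ window a (suc d)                    ∎
  where open ≡-Reasoning

window-off : ∀ a d → term (d + a) ≡ + 0 → window a (suc d) ≡ window a d
window-off a d t≡0 = trans (cong (λ t → window a d ℤ.+ t) t≡0) (ℤP.+-identityʳ (window a d))

window-on : ∀ a d → window a d ≡ + 0 → window a (suc d) ≡ term (d + a)
window-on a d w≡0 = trans (cong (ℤ._+ term (d + a)) w≡0) (ℤP.+-identityˡ (term (d + a)))

round-down : ∀ m s a .{{_ : NonZero m}} → m ∣ a → s < m → m * ((s + a) / m) ≡ a
round-down m s a m∣a s<m = begin
  m * ((s + a) / m)     ≡⟨ cong (m *_) (+-distrib-/-∣ʳ s m∣a) ⟩
  m * (s / m + a / m)   ≡⟨ cong (λ q → m * (q + a / m)) (m<n⇒m/n≡0 s<m) ⟩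
  m * (a / m)           ≡⟨ m*[n/m]≡n m∣a ⟩
  a                     ∎
  where open ≡-Reasoning

Δ₃-window : ∀ s a → 4 ∣ a → s < 4 → Δ₃ (s + a) ≡ window a s
Δ₃-window s a 4∣a s<4 = begin
  S30 (s + a) ℤ.- S30 (4 * ((s + a) / 4))   ≡⟨ cong (λ b → S30 (s + a) ℤ.- S30 b) (round-down 4 s a 4∣a s<4) ⟩
  S30 (s + a) ℤ.- S30 a                     ≡⟨ cong (ℤ._- S30 a) (S30-split s a) ⟩
  (S30 a ℤ.+ window a s) ℤ.- S30 a          ≡⟨ xyx⁻¹≈y (S30 a) (window a s) ⟩
  window a s                                ∎
  where open ≡-Reasoning

module Block (k : ℕ) where
  B : ℕ
  B = k * 12

  mod12 : ∀ c → (c + B) % 12 ≡ c % 12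
  mod12 c = [m+kn]%n≡m%n c k 12

  mod3 : ∀ c → (c + B) % 3 ≡ c % 3
  mod3 c = subst (λ b → (c + b) % 3 ≡ c % 3) (*-assoc k 4 3) ([m+kn]%n≡m%n c (k * 4) 3)

  on : ∀ c → c % 3 ≡ 0 → term (c + B) ≡ neg1^ (s₂ (c + B))
  on c c≡0 = term-on (c + B) (trans (mod3 c) c≡0)

  off : ∀ c → c % 3 ≢ 0 → term (c + B) ≡ + 0
  off c c≢0 = term-off (c + B) (λ e → c≢0 (trans (sym (mod3 c)) e))

  Δ₃-from : ∀ s c {s<4 : True (s <? 4)} {4∣c : True (4 ∣? c)} →
            Δ₃ (s + (c + B)) ≡ window (c + B) s
  Δ₃-from s c {s<4} {4∣c} =
    Δ₃-window s (c + B) (∣m∣n⇒∣m+n (toWitness 4∣c) (divides (k * 3) (sym (*-assoc k 3 4)))) (toWitness s<4)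

  -- Each window holds at most one index ≡ 0 mod 3; the other terms are discarded one by one.
  Δ₃-block : ∀ r → r < 12 → Δ₃ (r + B) ≡ Δ₃-rhs (r + B)
  Δ₃-block 0  _ rewrite mod12 0  = Δ₃-from 0 0
  Δ₃-block 1  _ rewrite mod12 1  = trans (Δ₃-from 1 0) (trans (window-on (0 + B) 0 refl) (on 0 refl))
  Δ₃-block 2  _ rewrite mod12 2  =
    trans (Δ₃-from 2 0) (trans (window-off (0 + B) 1 (off 1 λ ())) (trans (window-on (0 + B) 0 refl) (on 0 refl)))
  Δ₃-block 3  _ rewrite mod12 3  =
    trans (Δ₃-from 3 0) (trans (window-off (0 + B) 2 (off 2 λ ())) (trans (window-off (0 + B) 1 (off 1 λ ()))
      (trans (window-on (0 + B) 0 refl) (on 0 refl))))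
  Δ₃-block 4  _ rewrite mod12 4  = Δ₃-from 0 4
  Δ₃-block 5  _ rewrite mod12 5  = trans (Δ₃-from 1 4) (window-off (4 + B) 0 (off 4 λ ()))
  Δ₃-block 6  _ rewrite mod12 6  =
    trans (Δ₃-from 2 4) (trans (window-off (4 + B) 1 (off 5 λ ())) (window-off (4 + B) 0 (off 4 λ ())))
  Δ₃-block 7  _ rewrite mod12 7  =
    trans (Δ₃-from 3 4)
      (trans (window-on (4 + B) 2 (trans (window-off (4 + B) 1 (off 5 λ ())) (window-off (4 + B) 0 (off 4 λ ()))))
        (on 6 refl))
  Δ₃-block 8  _ rewrite mod12 8  = Δ₃-from 0 8
  Δ₃-block 9  _ rewrite mod12 9  = trans (Δ₃-from 1 8) (window-off (8 + B) 0 (off 8 λ ()))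
  Δ₃-block 10 _ rewrite mod12 10 =
    trans (Δ₃-from 2 8) (trans (window-on (8 + B) 1 (window-off (8 + B) 0 (off 8 λ ()))) (on 9 refl))
  Δ₃-block 11 _ rewrite mod12 11 =
    trans (Δ₃-from 3 8) (trans (window-off (8 + B) 2 (off 10 λ ()))
      (trans (window-on (8 + B) 1 (window-off (8 + B) 0 (off 8 λ ()))) (on 9 refl)))
  Δ₃-block (suc (suc (suc (suc (suc (suc (suc (suc (suc (suc (suc (suc _))))))))))))
    (s≤s (s≤s (s≤s (s≤s (s≤s (s≤s (s≤s (s≤s (s≤s (s≤s (s≤s (s≤s ()))))))))))))

lemma2 : (x : ℕ) → Δ₃ x ≡ Δ₃-rhs x
lemma2 x = subst (λ y → Δ₃ y ≡ Δ₃-rhs y) (sym (m≡m%n+[m/n]*n x 12))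
                 (Block.Δ₃-block (x / 12) (x % 12) (m%n<n x 12))
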